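{- Let $i\in\{1,2\}$ and let $r,s,n\geq 0$ be integers. Let $H_i(r,s,n)$ denote the number of partitions of $n$ with exactly $r$ even parts and exactly $s$ odd parts such that (1) the odd parts are distinct, (2) if $r\geq 1$, the smallest even part is greater than or equal to $2\,(r+s+i-1)$ (where $r+s$ is the length, i.e. the total number of parts, of the partition), and (3) if $s\geq 1$, the smallest odd part is greater than or equal to $2i-1$. Let $G_i(r,s,n)$ denote the number of partitions of $n$ with exactly $r$ even parts and exactly $s$ odd parts such that all parts are greater than or equal to $2i-1$, no two parts are equal or consecutive integers (i.e. any two parts differ by at least $2$), and no two even parts are equal or consecutive even integers (i.e. any two even parts differ by at least $4$). Then $H_i(r,s,n)=G_i(r,s,n)$.
   Context: A partition of a nonnegative integer $n$ is a weakly decreasing finite sequence of positive integers (its parts) summing to $n$; the empty partition is the unique partition of $0$. The length of a partition is its number of parts. -}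

module Defs where

open import Data.Nat using (ℕ; zero; suc; _+_; _*_; _≤_; _≥_; _∸_)
open import Data.Nat.Properties using ()
open import Data.Bool using (Bool; true; false; if_then_else_)
open import Data.List using (List; []; _∷_; length; filter)
open import Data.Nat.ListAction using (sum)
open import Data.Sum using (_⊎_)
open import Relation.Binary.PropositionalEquality using (_≡_; _≢_)
open import Data.List.Relation.Unary.All using (All)
open import Data.List.Relation.Unary.AllPairs using (AllPairs)
open import Data.List.Relation.Unary.Linked using (Linked)
open import Data.Nat.Divisibility using (_∣_)
open import Relation.Nullary using (¬_)
open import Data.Product using (_×_; Σ)
open import Relation.Unary using (Decidable)

Even : ℕ → Set
Even k = 2 ∣ k

Odd : ℕ → Set
Odd k = ¬ (2 ∣ k)

even? : Decidable Even
even? k = Data.Nat.Divisibility._∣?_ 2 k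

odd? : Decidable Odd
odd? k = Relation.Nullary.¬? (even? k)

IsPartition : ℕ → List ℕ → Set
IsPartition n ps = All (λ p → 1 ≤ p) ps × Linked (λ a b → b ≤ a) ps × sum ps ≡ n

evenParts : List ℕ → List ℕ
evenParts = filter even?

oddParts : List ℕ → List ℕ
oddParts = filter odd?

numEven numOdd : List ℕ → ℕ
numEven ps = length (evenParts ps)
numOdd ps = length (oddParts ps)

-- two numbers differ by at least d (d = 1: distinct). Both disjuncts
-- cannot hold for d ≥ 1, so this is proof-irrelevant.
DiffAtLeast : ℕ → ℕ → ℕ → Set
DiffAtLeast d a b = (d + b ≤ a) ⊎ (d + a ≤ b)

-- Guards "if r ≥ 1 then P" are encoded as (r ≡ 0 ⊎ (1 ≤ r × P)), an
-- exclusive (hence proof-irrelevant) form; "smallest even part ≥ c" is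
-- rendered as "every even part ≥ c".
-- i ∈ {1,2} is given as a natural number with an explicit hypothesis.
HPart : ℕ → ℕ → ℕ → ℕ → List ℕ → Set
HPart i r s n ps =
  IsPartition n ps × numEven ps ≡ r × numOdd ps ≡ s
  × AllPairs (DiffAtLeast 1) (oddParts ps)
  × (r ≡ 0 ⊎ (1 ≤ r × All (λ e → 2 * (r + s + i ∸ 1) ≤ e) (evenParts ps)))
  × (s ≡ 0 ⊎ (1 ≤ s × All (λ o → 2 * i ∸ 1 ≤ o) (oddParts ps)))

GPart : ℕ → ℕ → ℕ → ℕ → List ℕ → Set
GPart i r s n ps =
  IsPartition n ps × numEven ps ≡ r × numOdd ps ≡ s
  × All (λ p → 2 * i ∸ 1 ≤ p) ps
  × AllPairs (DiffAtLeast 2) ps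
  × AllPairs (DiffAtLeast 4) (evenParts ps)

{-# OPTIONS --safe #-}
-- Write i = c + 1 and m = r + s. Both kinds of partitions of n correspond to pairs
-- (o , u) of partitions, o into s odd parts ≥ 2i − 1 and u into r even parts ≥ 2i,
-- with |o| + |u| + s(s − 1) + 2r(m − 1) = n.
-- An H-partition yields o by removing the staircase 2(s − 1), …, 2, 0 from its
-- distinct odd parts and u by subtracting 2(m − 1) from each even part.
-- Removing the staircase 2(m − 1), …, 2, 0 from a G-partition turns gaps ≥ 2 into
-- weak descents and gaps ≥ 4 between even parts into gaps ≥ 2, leaving a weakly
-- decreasing sequence with distinct even entries (it suffices to compare neighbours,
-- since an odd entry between two even ones already separates them). Its odd entries
-- form o and its even entries, minus the staircase 2(r − 1), …, 2, 0, form u; the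
-- weights agree because m(m − 1) + r(r − 1) = s(s − 1) + 2r(m − 1).
module Submission where

open import Defs
open import Data.Nat using (ℕ; zero; suc; _+_; _*_; _∸_; _≤_; _≥_; _<_; z≤n; s≤s)
open import Data.Nat.Properties
open import Data.Nat.Divisibility using (∣m∣n⇒∣m+n; ∣m+n∣m⇒∣n; ∣n⇒∣m*n; ∣-refl; m∣m*n; ∣1⇒≡1)
open import Data.Nat.ListAction using (sum)
open import Data.Nat.ListAction.Properties using (sum-++; sum-↭)
open import Data.Nat.Tactic.RingSolver using (solve-∀)
open import Data.List using (List; []; _∷_; length; filter; map; merge)
open import Data.List.Properties using (filter-accept; filter-reject; filter-all; filter-none; length-++; length-map)
open import Data.List.Relation.Unary.All as All using (All; []; _∷_)
import Data.List.Relation.Unary.All.Properties as All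
open import Data.List.Relation.Unary.AllPairs as AllPairs using (AllPairs; []; _∷_)
open import Data.List.Relation.Unary.Linked as Linked using (Linked; []; [-]; _∷_)
import Data.List.Relation.Unary.Linked.Properties as Linked
open import Data.List.Relation.Unary.Linked.Properties using (Linked⇒AllPairs; AllPairs⇒Linked)
open import Data.List.Relation.Unary.Sorted.TotalOrder.Properties using (merge⁺)
open import Data.List.Relation.Binary.Permutation.Propositional using (↭-sym)
open import Data.List.Relation.Binary.Permutation.Propositional.Properties using (merge-↭; All-resp-↭; ↭-length)
open import Data.Product using (Σ; _×_; _,_; proj₁; proj₂)
open import Data.Sum using (_⊎_; inj₁; inj₂)
open import Function using (_∘_)
open import Function.Bundles using (_⇔_; mk⇔; Equivalence; _↔_; mk↔ₛ′)
open import Relation.Binary.PropositionalEquality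
open ≡-Reasoning
import Relation.Binary as B
open import Relation.Binary.Properties.DecTotalOrder ≤-decTotalOrder using (≥-decTotalOrder)
open import Relation.Nullary using (¬_; ¬?; yes; no; contradiction; Irrelevant)
open import Relation.Unary using (Pred; Decidable; ∁)

private
  variable
    d k ℓ b x y : ℕ
    xs ys : List ℕ

even-+ : Even x → Even y → Even (x + y)
even-+ = ∣m∣n⇒∣m+n

even-+⁻ : Even x → Even (x + y) → Even y
even-+⁻ ex exy = ∣m+n∣m⇒∣n exy ex

even-shift : Even x → Even (x + y) ⇔ Even y
even-shift ex = mk⇔ (even-+⁻ ex) (even-+ ex)

odd-shift : Even x → Odd (x + y) ⇔ Odd y
odd-shift ex = mk⇔ (λ oxy ey → oxy (even-+ ex ey)) (λ oy exy → oy (even-+⁻ ex exy))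

even-0 : Even 0
even-0 = m∣m*n 0

even-2 : Even 2
even-2 = ∣-refl

even⊎even-suc : ∀ n → Even n ⊎ Even (suc n)
even⊎even-suc zero    = inj₁ even-0
even⊎even-suc (suc n) with even⊎even-suc n
... | inj₁ en  = inj₂ (even-+ even-2 en)
... | inj₂ esn = inj₁ esn

odd-1 : Odd 1
odd-1 e with ∣1⇒≡1 e
... | ()

odd-suc-double : ∀ c → Odd (suc (2 * c))
odd-suc-double c = subst Odd (+-comm (2 * c) 1) (Equivalence.from (odd-shift (m∣m*n c)) odd-1)

even≤odd⇒< : Even x → Odd y → x ≤ y → x < y
even≤odd⇒< ex oy x≤y = ≤∧≢⇒< x≤y (λ { refl → oy ex })

odd≤even⇒< : Odd x → Even y → x ≤ y → x < y
odd≤even⇒< ox ey x≤y = ≤∧≢⇒< x≤y (λ { refl → ox ey })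

odd<odd⇒2+≤ : Odd x → Odd y → x < y → 2 + x ≤ y
odd<odd⇒2+≤ {x} ox oy x<y with even⊎even-suc x
... | inj₁ ex  = contradiction ex ox
... | inj₂ esx = even≤odd⇒< esx oy x<y

Spaced : ℕ → List ℕ → Set
Spaced k = Linked (λ x y → k + y ≤ x)

Spaced-trans : ∀ k {x y z} → k + y ≤ x → k + z ≤ y → k + z ≤ x
Spaced-trans k {x} {y} {z} y≤x z≤y = ≤-trans z≤y (≤-trans (m≤n+m y k) y≤x)

Spaced-mono : ℓ ≤ k → Spaced k xs → Spaced ℓ xs
Spaced-mono ℓ≤k = Linked.map (≤-trans (+-monoˡ-≤ _ ℓ≤k))

Apart : ℕ → ℕ → ℕ → ℕ → Set
Apart k ℓ x y = k + y ≤ x × (Even x → Even y → ℓ + y ≤ x)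

module _ {p} {P : Pred ℕ p} (P? : Decidable P) {q} {R : ℕ → ℕ → Set q} where

  AllPairs-filter⁺ : AllPairs (λ x y → P x → P y → R x y) xs → AllPairs R (filter P? xs)
  AllPairs-filter⁺                []          = []
  AllPairs-filter⁺ {x ∷ xs} (rx ∷ rxs) with P? x
  ... | yes px = All.zipWith (λ (r , py) → r px py) (All.filter⁺ P? rx , All.all-filter P? xs)
                 ∷ AllPairs-filter⁺ rxs
  ... | no  _  = AllPairs-filter⁺ rxs

  AllPairs-filter⁻ : AllPairs R (filter P? xs) → AllPairs (λ x y → P x → P y → R x y) xs
  AllPairs-filter⁻ {[]}     []  = []
  AllPairs-filter⁻ {x ∷ xs} rs with P? x
  ... | yes px with rx ∷ rxs ← rs =
    All.filter⁻ P? (All.map (λ r _ _ → r) rx)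
                   (All.map (λ ¬py _ py → contradiction py ¬py) (All.all-filter (¬? ∘ P?) xs))
    ∷ AllPairs-filter⁻ rxs
  ... | no ¬px = All.universal (λ _ px → contradiction px ¬px) xs ∷ AllPairs-filter⁻ rs

Apart-trans : Even k → B.Transitive (Apart k (2 + k))
Apart-trans {k} ek {x} {y} {z} (y≤x , evenGap-xy) (z≤y , evenGap-yz) = Spaced-trans k y≤x z≤y , evenGap
  where
  evenGap : Even x → Even z → 2 + k + z ≤ x
  evenGap ex ez with even? y
  ... | yes ey = ≤-trans (evenGap-yz ey ez) (≤-trans (m≤n+m y k) y≤x)
  ... | no  oy = ≤-trans (s≤s (even≤odd⇒< (even-+ ek ez) oy z≤y))
                         (≤-trans (s≤s (m≤n+m y k)) (odd≤even⇒< (Equivalence.from (odd-shift ek) oy) ex y≤x))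

Linked-Apart⇔ : Even k → Linked (Apart k (2 + k)) xs ⇔ (Spaced k xs × Spaced (2 + k) (evenParts xs))
Linked-Apart⇔ {k} ek = mk⇔
  (λ apart → Linked.map proj₁ apart
           , AllPairs⇒Linked (AllPairs-filter⁺ even? (AllPairs.map proj₂ (Linked⇒AllPairs (Apart-trans ek) apart))))
  (λ (sp , spEven) → AllPairs⇒Linked (AllPairs.zip
    ( Linked⇒AllPairs (Spaced-trans k) sp
    , AllPairs-filter⁻ even? (Linked⇒AllPairs (Spaced-trans (2 + k)) spEven))))

DiffAtLeast⇒Spaced : Linked _≥_ xs → AllPairs (DiffAtLeast k) xs → Spaced k xs
DiffAtLeast⇒Spaced {k = k} desc diff = Linked.zipWith resolve (desc , AllPairs⇒Linked diff)
  where
  resolve : ∀ {x y} → y ≤ x × DiffAtLeast k x y → k + y ≤ x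
  resolve (_   , inj₁ k+y≤x) = k+y≤x
  resolve (y≤x , inj₂ k+x≤y) = ≤-trans (+-monoʳ-≤ k y≤x) (≤-trans k+x≤y y≤x)

Spaced⇒DiffAtLeast : Spaced k xs → AllPairs (DiffAtLeast k) xs
Spaced⇒DiffAtLeast {k} = AllPairs.map inj₁ ∘ Linked⇒AllPairs (Spaced-trans k)

Spaced-odd : All Odd xs → Spaced 1 xs → Spaced 2 xs
Spaced-odd _                  []            = []
Spaced-odd _                  [-]           = [-]
Spaced-odd (ox ∷ oys@(oy ∷ _)) (y<x ∷ sp) = odd<odd⇒2+≤ oy ox y<x ∷ Spaced-odd oys sp

stair : ℕ → List ℕ → List ℕ
stair d []       = []
stair d (x ∷ xs) = length xs * d + x ∷ stair d xs

unstair : ℕ → List ℕ → List ℕ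
unstair d []       = []
unstair d (x ∷ xs) = x ∸ length xs * d ∷ unstair d xs

length-stair : ∀ d xs → length (stair d xs) ≡ length xs
length-stair d []       = refl
length-stair d (x ∷ xs) = cong suc (length-stair d xs)

length-unstair : ∀ d xs → length (unstair d xs) ≡ length xs
length-unstair d []       = refl
length-unstair d (x ∷ xs) = cong suc (length-unstair d xs)

unstair-stair : ∀ d xs → unstair d (stair d xs) ≡ xs
unstair-stair d []       = refl
unstair-stair d (x ∷ xs) =
  cong₂ _∷_ (trans (cong (λ m → length xs * d + x ∸ m * d) (length-stair d xs)) (m+n∸m≡n (length xs * d) x))
            (unstair-stair d xs)

Spaced⇒length*≤head : Spaced d (x ∷ xs) → length xs * d ≤ x
Spaced⇒length*≤head [-]           = z≤n
Spaced⇒length*≤head (d+y≤x ∷ sp) = ≤-trans (+-monoʳ-≤ _ (Spaced⇒length*≤head sp)) d+y≤x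

stair-unstair : ∀ d xs → Spaced d xs → stair d (unstair d xs) ≡ xs
stair-unstair d []       _  = refl
stair-unstair d (x ∷ xs) sp = cong₂ _∷_ head-eq (stair-unstair d xs (Linked.tail sp))
  where
  head-eq : length (unstair d xs) * d + (x ∸ length xs * d) ≡ x
  head-eq rewrite length-unstair d xs = m+[n∸m]≡n (Spaced⇒length*≤head sp)

module _ {R R′ : ℕ → ℕ → Set} where

  Linked-stair⁺ : (∀ {x y} n → R x y → R′ (suc n * d + x) (n * d + y)) →
                  Linked R xs → Linked R′ (stair d xs)
  Linked-stair⁺ shift []         = []
  Linked-stair⁺ shift [-]        = [-]
  Linked-stair⁺ {xs = x ∷ y ∷ ys} shift (Rxy ∷ rs) = shift (length ys) Rxy ∷ Linked-stair⁺ shift rs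

  Linked-stair⁻ : (∀ {x y} n → R′ (suc n * d + x) (n * d + y) → R x y) →
                  Linked R′ (stair d xs) → Linked R xs
  Linked-stair⁻ {xs = []}         shift []         = []
  Linked-stair⁻ {xs = x ∷ []}     shift [-]        = [-]
  Linked-stair⁻ {xs = x ∷ y ∷ ys} shift (R′xy ∷ rs) = shift (length ys) R′xy ∷ Linked-stair⁻ shift rs

module _ {p} {P : Pred ℕ p} where

  All-stair⁺ : (∀ {x} n → P x → P (n * d + x)) → All P xs → All P (stair d xs)
  All-stair⁺ shift []                  = []
  All-stair⁺ shift (_∷_ {xs = xs} px pxs) = shift (length xs) px ∷ All-stair⁺ shift pxs

  All-stair⁻ : (∀ {x} n → P (n * d + x) → P x) → All P (stair d xs) → All P xs
  All-stair⁻ {xs = []}     shift []         = []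
  All-stair⁻ {xs = x ∷ xs} shift (px ∷ pxs) = shift (length xs) px ∷ All-stair⁻ shift pxs

  count-stair : (P? : Decidable P) → (∀ n {x} → P (n * d + x) ⇔ P x) →
                ∀ xs → length (filter P? (stair d xs)) ≡ length (filter P? xs)
  count-stair {d} P? shift [] = refl
  count-stair {d} P? shift (x ∷ xs) with P? (length xs * d + x) | P? x
  ... | yes _   | yes _  = cong suc (count-stair P? shift xs)
  ... | no  _   | no  _  = count-stair P? shift xs
  ... | yes px′ | no ¬px = contradiction (Equivalence.to (shift (length xs)) px′) ¬px
  ... | no ¬px′ | yes px = contradiction (Equivalence.from (shift (length xs)) px) ¬px′

All-≤-stair⁻ : Linked _≥_ xs → All (b ≤_) (stair d xs) → All (b ≤_) xs
All-≤-stair⁻ []              []          = []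
All-≤-stair⁻ [-]             (b≤x ∷ [])  = b≤x ∷ []
All-≤-stair⁻ (y≤x ∷ desc) (_ ∷ bs) with All-≤-stair⁻ desc bs
... | b≤y ∷ b≤ys = ≤-trans b≤y y≤x ∷ b≤y ∷ b≤ys

triangle : ℕ → ℕ
triangle zero    = 0
triangle (suc n) = n + triangle n

sum-stair : ∀ d xs → sum (stair d xs) ≡ triangle (length xs) * d + sum xs
sum-stair d []       = refl
sum-stair d (x ∷ xs) =
  trans (cong (length xs * d + x +_) (sum-stair d xs)) (arith (length xs) (triangle (length xs)) d x (sum xs))
  where
  arith : ∀ l t d x s → l * d + x + (t * d + s) ≡ (l + t) * d + (x + s)
  arith = solve-∀

stair-step-≤ : ∀ d n k x y → (d + k) + (n * d + y) ≤ suc n * d + x ⇔ k + y ≤ x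
stair-step-≤ d n k x y = mk⇔
  (λ le → +-cancelˡ-≤ (d + n * d) _ _ (subst (_≤ suc n * d + x) (regroup d k n y) le))
  (λ le → subst (_≤ suc n * d + x) (sym (regroup d k n y)) (+-monoʳ-≤ (d + n * d) le))
  where
  regroup : ∀ d k n y → (d + k) + (n * d + y) ≡ (d + n * d) + (k + y)
  regroup = solve-∀

even-stair-shift : Even d → ∀ n {x} → Even (n * d + x) ⇔ Even x
even-stair-shift ed n = even-shift (∣n⇒∣m*n n ed)

odd-stair-shift : Even d → ∀ n {x} → Odd (n * d + x) ⇔ Odd x
odd-stair-shift ed n = odd-shift (∣n⇒∣m*n n ed)

Spaced-stair⁺ : Spaced k xs → Spaced (d + k) (stair d xs)
Spaced-stair⁺ {k} {d = d} = Linked-stair⁺ (λ n → Equivalence.from (stair-step-≤ d n k _ _))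

Spaced-stair⁻ : Spaced (d + k) (stair d xs) → Spaced k xs
Spaced-stair⁻ {d} {k} = Linked-stair⁻ (λ n → Equivalence.to (stair-step-≤ d n k _ _))

Apart-stair⇔ : Even d → ∀ n → Apart k ℓ x y ⇔ Apart (d + k) (d + ℓ) (suc n * d + x) (n * d + y)
Apart-stair⇔ {d} {k} {ℓ} {x} {y} ed n = mk⇔
  (λ (gap , evenGap) → from (step k) gap , λ ex ey → from (step ℓ) (evenGap (to upper ex) (to lower ey)))
  (λ (gap , evenGap) → to (step k) gap , λ ex ey → to (step ℓ) (evenGap (from upper ex) (from lower ey)))
  where
  open Equivalence
  step : ∀ j → (d + j) + (n * d + y) ≤ suc n * d + x ⇔ j + y ≤ x
  step j = stair-step-≤ d n j x y
  upper = even-stair-shift ed (suc n) {x}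
  lower = even-stair-shift ed n {y}

module _ {p q} {P : Pred ℕ p} (P? : Decidable P) {R : ℕ → ℕ → Set q} (R? : B.Decidable R) where

  filter-mergeˡ : ∀ xs ys → All P xs → All (∁ P) ys → filter P? (merge R? xs ys) ≡ xs
  filter-mergeˡ []       ys       []         ¬pys = filter-none P? ¬pys
  filter-mergeˡ (x ∷ xs) []       pxs        []   = filter-all P? pxs
  filter-mergeˡ (x ∷ xs) (y ∷ ys) (px ∷ pxs) (¬py ∷ ¬pys)
    with R? x y | filter-mergeˡ xs (y ∷ ys) pxs (¬py ∷ ¬pys) | filter-mergeˡ (x ∷ xs) ys (px ∷ pxs) ¬pys
  ... | yes _ | left | _     = trans (filter-accept P? px) (cong (x ∷_) left)
  ... | no  _ | _    | right = trans (filter-reject P? ¬py) right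

  filter-mergeʳ : ∀ xs ys → All (∁ P) xs → All P ys → filter P? (merge R? xs ys) ≡ ys
  filter-mergeʳ []       ys       []           pys = filter-all P? pys
  filter-mergeʳ (x ∷ xs) []       ¬pxs         []  = filter-none P? ¬pxs
  filter-mergeʳ (x ∷ xs) (y ∷ ys) (¬px ∷ ¬pxs) (py ∷ pys)
    with R? x y | filter-mergeʳ xs (y ∷ ys) ¬pxs (py ∷ pys) | filter-mergeʳ (x ∷ xs) ys (¬px ∷ ¬pxs) pys
  ... | yes _ | left | _     = trans (filter-reject P? ¬px) left
  ... | no  _ | _    | right = trans (filter-accept P? py) (cong (y ∷_) right)

module _ {q} {R : ℕ → ℕ → Set q} (R? : B.Decidable R) where

  All-merge : ∀ {p} {P : Pred ℕ p} → All P xs → All P ys → All P (merge R? xs ys)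
  All-merge {xs} {ys} pxs pys = All-resp-↭ (↭-sym (merge-↭ R? xs ys)) (All.++⁺ pxs pys)

  sum-merge : ∀ xs ys → sum (merge R? xs ys) ≡ sum xs + sum ys
  sum-merge xs ys = trans (sum-↭ (merge-↭ R? xs ys)) (sum-++ xs ys)

  length-merge : ∀ xs ys → length (merge R? xs ys) ≡ length xs + length ys
  length-merge xs ys = trans (↭-length (merge-↭ R? xs ys)) (length-++ xs)

  merge-∷ˡ : All (R x) ys → merge R? (x ∷ xs) ys ≡ x ∷ merge R? xs ys
  merge-∷ˡ {xs = []}    []  = refl
  merge-∷ˡ {xs = _ ∷ _} []  = refl
  merge-∷ˡ {x} {y ∷ ys} (Rxy ∷ _) with R? x y
  ... | yes _ = refl
  ... | no ¬Rxy = contradiction Rxy ¬Rxy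

  merge-∷ʳ : All (λ x → ¬ R x y) xs → merge R? xs (y ∷ ys) ≡ y ∷ merge R? xs ys
  merge-∷ʳ {xs = []} [] = refl
  merge-∷ʳ {y} {x ∷ xs} (¬Rxy ∷ _) with R? x y
  ... | yes Rxy = contradiction Rxy ¬Rxy
  ... | no _    = refl

Linked-merge : Linked _≥_ xs → Linked _≥_ ys → Linked _≥_ (merge _≥?_ xs ys)
Linked-merge = merge⁺ ≥-decTotalOrder

merge-oddParts-evenParts : Linked _≥_ xs → merge _≥?_ (oddParts xs) (evenParts xs) ≡ xs
merge-oddParts-evenParts = go ∘ Linked⇒AllPairs (Spaced-trans 0)
  where
  go : AllPairs _≥_ xs → merge _≥?_ (oddParts xs) (evenParts xs) ≡ xs
  go []                        = refl
  go {x ∷ xs} (x≥xs ∷ desc) with even? x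
  ... | yes ex = begin
    merge _≥?_ (oddParts (x ∷ xs)) (evenParts (x ∷ xs))
      ≡⟨ cong₂ (merge _≥?_) (filter-reject odd? (λ ox → ox ex)) (filter-accept even? ex) ⟩
    merge _≥?_ (oddParts xs) (x ∷ evenParts xs)
      ≡⟨ merge-∷ʳ _≥?_ (All.zipWith odd-below (All.filter⁺ odd? x≥xs , All.all-filter odd? xs)) ⟩
    x ∷ merge _≥?_ (oddParts xs) (evenParts xs)
      ≡⟨ cong (x ∷_) (go desc) ⟩
    x ∷ xs ∎
    where
    odd-below : ∀ {y} → x ≥ y × Odd y → ¬ y ≥ x
    odd-below (y≤x , oy) = <⇒≱ (odd≤even⇒< oy ex y≤x)
  ... | no ox = begin
    merge _≥?_ (oddParts (x ∷ xs)) (evenParts (x ∷ xs))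
      ≡⟨ cong₂ (merge _≥?_) (filter-accept odd? ox) (filter-reject even? ox) ⟩
    merge _≥?_ (x ∷ oddParts xs) (evenParts xs)
      ≡⟨ merge-∷ˡ _≥?_ (All.filter⁺ even? x≥xs) ⟩
    x ∷ merge _≥?_ (oddParts xs) (evenParts xs)
      ≡⟨ cong (x ∷_) (go desc) ⟩
    x ∷ xs ∎

map-+-∸ : ∀ δ xs → All (δ ≤_) xs → map (δ +_) (map (_∸ δ) xs) ≡ xs
map-+-∸ δ []       []           = refl
map-+-∸ δ (x ∷ xs) (δ≤x ∷ δ≤xs) = cong₂ _∷_ (m+[n∸m]≡n δ≤x) (map-+-∸ δ xs δ≤xs)

map-∸-+ : ∀ δ xs → map (_∸ δ) (map (δ +_) xs) ≡ xs
map-∸-+ δ []       = refl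
map-∸-+ δ (x ∷ xs) = cong₂ _∷_ (m+n∸m≡n δ x) (map-∸-+ δ xs)

sum-map-+ : ∀ δ xs → sum (map (δ +_) xs) ≡ length xs * δ + sum xs
sum-map-+ δ []       = refl
sum-map-+ δ (x ∷ xs) = trans (cong (δ + x +_) (sum-map-+ δ xs)) (regroup δ x (length xs) (sum xs))
  where
  regroup : ∀ δ x l s → δ + x + (l * δ + s) ≡ (δ + l * δ) + (x + s)
  regroup = solve-∀

module _ {p} {P : Pred ℕ p} where

  unguard : (k ≡ 0 ⊎ (1 ≤ k × All P xs)) → length xs ≡ k → All P xs
  unguard {xs = []}    _                 _  = []
  unguard {xs = _ ∷ _} (inj₂ (_ , pxs)) _  = pxs
  unguard {xs = _ ∷ _} (inj₁ refl)      ()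

  guard : length xs ≡ k → All P xs → (k ≡ 0 ⊎ (1 ≤ k × All P xs))
  guard {xs = []}    refl _   = inj₁ refl
  guard {xs = _ ∷ _} refl pxs = inj₂ (s≤s z≤n , pxs)

-- Only ever added to the r even parts, so the truncation at r + s = 0 never matters.
evenShift : ℕ → ℕ → ℕ
evenShift r s = 2 * (r + s ∸ 1)

evenShift-even : ∀ r s → Even (evenShift r s)
evenShift-even r s = m∣m*n (r + s ∸ 1)

2*suc∸1 : ∀ c → 2 * suc c ∸ 1 ≡ suc (2 * c)
2*suc∸1 c = +-suc c (c + 0)

even-bound-shift : ∀ {r} s c u → length u ≡ r →
                   All (2 + 2 * c ≤_) u ⇔ All (2 * (r + s + suc c ∸ 1) ≤_) (map (evenShift r s +_) u)
even-bound-shift s c []      refl = mk⇔ (λ _ → []) (λ _ → [])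
even-bound-shift s c (x ∷ xs) refl =
  mk⇔ (All.map⁺ ∘ All.map (Equivalence.to pointwise)) (All.map (Equivalence.from pointwise) ∘ All.map⁻)
  where
  δ = 2 * (length xs + s)
  pointwise : ∀ {e} → 2 + 2 * c ≤ e ⇔ 2 * (length xs + s + suc c) ≤ δ + e
  pointwise {e} rewrite *-distribˡ-+ 2 (length xs + s) (suc c) | *-suc 2 c =
    mk⇔ (+-monoʳ-≤ δ) (+-cancelˡ-≤ δ _ _)

record PartitionPair (c r s : ℕ) (ou : List ℕ × List ℕ) : Set where
  field
    odd-desc    : Linked _≥_ (proj₁ ou)
    odd-odd     : All Odd (proj₁ ou)
    odd-bound   : All (suc (2 * c) ≤_) (proj₁ ou)
    odd-length  : length (proj₁ ou) ≡ s
    even-desc   : Linked _≥_ (proj₂ ou)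
    even-even   : All Even (proj₂ ou)
    even-bound  : All (2 + 2 * c ≤_) (proj₂ ou)
    even-length : length (proj₂ ou) ≡ r

splitH : ℕ → List ℕ → List ℕ × List ℕ
splitH δ ps = unstair 2 (oddParts ps) , map (_∸ δ) (evenParts ps)

joinH : ℕ → List ℕ × List ℕ → List ℕ
joinH δ (o , u) = merge _≥?_ (stair 2 o) (map (δ +_) u)

module SplitH {c r s n ps} (H : HPart (suc c) r s n ps) where

  private
    δ = evenShift r s
    desc      = let (_ , desc , _) , _ = H in desc
    #even     = let _ , #even , _ = H in #even
    #odd      = let _ , _ , #odd , _ = H in #odd
    distinct  = let _ , _ , _ , distinct , _ = H in distinct
    evenBound = let _ , _ , _ , _ , evenGuard , _ = H in unguard evenGuard #even
    oddBound  = let _ , _ , _ , _ , _ , oddGuard = H in unguard oddGuard #odd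
    o = proj₁ (splitH δ ps)
    u = proj₂ (splitH δ ps)

    oddParts-spaced : Spaced 2 (oddParts ps)
    oddParts-spaced = Spaced-odd (All.all-filter odd? ps)
                                 (DiffAtLeast⇒Spaced (Linked.filter⁺ odd? (Spaced-trans 0) desc) distinct)

    stair-o : stair 2 o ≡ oddParts ps
    stair-o = stair-unstair 2 (oddParts ps) oddParts-spaced

    shift-u : map (δ +_) u ≡ evenParts ps
    shift-u = map-+-∸ δ (evenParts ps) (All.map (≤-trans δ≤bound) evenBound)
      where
      δ≤bound : δ ≤ 2 * (r + s + suc c ∸ 1)
      δ≤bound = *-monoʳ-≤ 2 (∸-monoˡ-≤ 1 (m≤m+n (r + s) (suc c)))

    o-desc : Linked _≥_ o
    o-desc = Spaced-stair⁻ {d = 2} (subst (Spaced 2) (sym stair-o) oddParts-spaced)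

    u-length : length u ≡ r
    u-length = trans (length-map (_∸ δ) (evenParts ps)) #even

  pair : PartitionPair c r s (splitH δ ps)
  pair = record
    { odd-desc    = o-desc
    ; odd-odd     = All-stair⁻ (λ n → Equivalence.to (odd-stair-shift even-2 n))
                               (subst (All Odd) (sym stair-o) (All.all-filter odd? ps))
    ; odd-bound   = All-≤-stair⁻ o-desc
                      (subst (All _) (sym stair-o) (All.map (λ {x} → subst (_≤ x) (2*suc∸1 c)) oddBound))
    ; odd-length  = trans (length-unstair 2 (oddParts ps)) #odd
    ; even-desc   = Linked.map (+-cancelˡ-≤ δ _ _)
                      (Linked.map⁻ (subst (Linked _≥_) (sym shift-u) (Linked.filter⁺ even? (Spaced-trans 0) desc)))
    ; even-even   = All.map (even-+⁻ (evenShift-even r s))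
                      (All.map⁻ (subst (All Even) (sym shift-u) (All.all-filter even? ps)))
    ; even-bound  = Equivalence.from (even-bound-shift s c u u-length) (subst (All _) (sym shift-u) evenBound)
    ; even-length = u-length
    }

  joinH-splitH : joinH δ (splitH δ ps) ≡ ps
  joinH-splitH = trans (cong₂ (merge _≥?_) stair-o shift-u) (merge-oddParts-evenParts desc)

module JoinH {c r s ou} (pp : PartitionPair c r s ou) where

  open PartitionPair pp
  private
    δ  = evenShift r s
    o  = proj₁ ou
    u  = proj₂ ou
    os = stair 2 o
    es = map (δ +_) u

    os-odd : All Odd os
    os-odd = All-stair⁺ (λ n → Equivalence.from (odd-stair-shift even-2 n)) odd-odd

    es-even : All Even es
    es-even = All.map⁺ (All.map (even-+ (evenShift-even r s)) even-even)

    os-spaced : Spaced 2 os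
    os-spaced = Spaced-stair⁺ {k = 0} odd-desc

    oddParts-joinH : oddParts (joinH δ ou) ≡ os
    oddParts-joinH = filter-mergeˡ odd? _≥?_ os es os-odd (All.map (λ e o → o e) es-even)

    evenParts-joinH : evenParts (joinH δ ou) ≡ es
    evenParts-joinH = filter-mergeʳ even? _≥?_ os es os-odd es-even

  splitH-joinH : splitH δ (joinH δ ou) ≡ ou
  splitH-joinH = cong₂ _,_ (trans (cong (unstair 2) oddParts-joinH) (unstair-stair 2 o))
                           (trans (cong (map (_∸ δ)) evenParts-joinH) (map-∸-+ δ u))

  HPart-joinH : ∀ {n} → sum (joinH δ ou) ≡ n → HPart (suc c) r s n (joinH δ ou)
  HPart-joinH sum≡n =
    ( All-merge _≥?_ (All.map (≤-trans (s≤s z≤n)) os-bound) (All.map⁺ (All.map positive even-bound))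
    , Linked-merge (Spaced-mono z≤n os-spaced)
                   (Linked.map⁺ (Linked.map (+-monoʳ-≤ δ) even-desc))
    , sum≡n )
    , #even
    , #odd
    , subst (AllPairs (DiffAtLeast 1)) (sym oddParts-joinH)
        (Spaced⇒DiffAtLeast (Spaced-mono (s≤s z≤n) os-spaced))
    , guard #even
        (subst (All _) (sym evenParts-joinH) (Equivalence.to (even-bound-shift s c u even-length) even-bound))
    , guard #odd
        (subst (All _) (sym oddParts-joinH) (All.map (λ {x} → subst (_≤ x) (sym (2*suc∸1 c))) os-bound))
    where
    #even : numEven (joinH δ ou) ≡ r
    #even = trans (cong length evenParts-joinH) (trans (length-map (δ +_) u) even-length)
    #odd : numOdd (joinH δ ou) ≡ s
    #odd = trans (cong length oddParts-joinH) (trans (length-stair 2 o) odd-length)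
    os-bound : All (suc (2 * c) ≤_) os
    os-bound = All-stair⁺ (λ {x} n b → ≤-trans b (m≤n+m x (n * 2))) odd-bound
    positive : ∀ {x} → 2 + 2 * c ≤ x → 1 ≤ δ + x
    positive {x} b = ≤-trans (≤-trans (s≤s z≤n) b) (m≤n+m x δ)

splitG : List ℕ → List ℕ × List ℕ
splitG g = oddParts (unstair 2 g) , unstair 2 (evenParts (unstair 2 g))

joinG : List ℕ × List ℕ → List ℕ
joinG (o , u) = stair 2 (merge _≥?_ o (stair 2 u))

module SplitG {c r s n g} (G : GPart (suc c) r s n g) where

  private
    desc  = let (_ , desc , _) , _ = G in desc
    #even = let _ , #even , _ = G in #even
    #odd  = let _ , _ , #odd , _ = G in #odd
    bound = let _ , _ , _ , bound , _ = G in bound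
    diff₂ = let _ , _ , _ , _ , diff₂ , _ = G in diff₂
    diff₄ = let _ , _ , _ , _ , _ , diff₄ = G in diff₄
    h = unstair 2 g
    u = proj₂ (splitG g)

    g-spaced : Spaced 2 g
    g-spaced = DiffAtLeast⇒Spaced desc diff₂

    stair-h : stair 2 h ≡ g
    stair-h = stair-unstair 2 g g-spaced

    h-apart : Linked (Apart 0 2) h
    h-apart = Linked-stair⁻ (λ n → Equivalence.from (Apart-stair⇔ even-2 n))
      (subst (Linked (Apart 2 4)) (sym stair-h) (Equivalence.from (Linked-Apart⇔ even-2)
        (g-spaced , DiffAtLeast⇒Spaced (Linked.filter⁺ even? (Spaced-trans 0) desc) diff₄)))

    h-desc : Linked _≥_ h
    h-desc = proj₁ (Equivalence.to (Linked-Apart⇔ even-0) h-apart)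

    stair-u : stair 2 u ≡ evenParts h
    stair-u = stair-unstair 2 (evenParts h) (proj₂ (Equivalence.to (Linked-Apart⇔ even-0) h-apart))

    u-desc : Linked _≥_ u
    u-desc = Spaced-stair⁻ {d = 2}
      (subst (Spaced 2) (sym stair-u) (proj₂ (Equivalence.to (Linked-Apart⇔ even-0) h-apart)))

    h-bound : All (suc (2 * c) ≤_) h
    h-bound = All-≤-stair⁻ h-desc (subst (All _) (sym stair-h) (All.map (λ {x} → subst (_≤ x) (2*suc∸1 c)) bound))

    count-h : ∀ {p} {P : Pred ℕ p} (P? : Decidable P) → (∀ n {x} → P (n * 2 + x) ⇔ P x) →
              length (filter P? h) ≡ length (filter P? g)
    count-h P? shift = trans (sym (count-stair P? shift h)) (cong (length ∘ filter P?) stair-h)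

  pair : PartitionPair c r s (splitG g)
  pair = record
    { odd-desc    = Linked.filter⁺ odd? (Spaced-trans 0) h-desc
    ; odd-odd     = All.all-filter odd? h
    ; odd-bound   = All.filter⁺ odd? h-bound
    ; odd-length  = trans (count-h odd? (odd-stair-shift even-2)) #odd
    ; even-desc   = u-desc
    ; even-even   = All-stair⁻ (λ n → Equivalence.to (even-stair-shift even-2 n))
                               (subst (All Even) (sym stair-u) (All.all-filter even? h))
    ; even-bound  = All-≤-stair⁻ u-desc (subst (All _) (sym stair-u)
                      (All.zipWith (λ (b , e) → odd≤even⇒< (odd-suc-double c) e b)
                                   (All.filter⁺ even? h-bound , All.all-filter even? h)))
    ; even-length = trans (length-unstair 2 (evenParts h)) (trans (count-h even? (even-stair-shift even-2)) #even)
    }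

  joinG-splitG : joinG (splitG g) ≡ g
  joinG-splitG = begin
    stair 2 (merge _≥?_ (oddParts h) (stair 2 u))   ≡⟨ cong (stair 2 ∘ merge _≥?_ (oddParts h)) stair-u ⟩
    stair 2 (merge _≥?_ (oddParts h) (evenParts h)) ≡⟨ cong (stair 2) (merge-oddParts-evenParts h-desc) ⟩
    stair 2 h                                       ≡⟨ stair-h ⟩
    g                                               ∎

module JoinG {c r s ou} (pp : PartitionPair c r s ou) where

  open PartitionPair pp
  private
    o  = proj₁ ou
    u  = proj₂ ou
    es = stair 2 u
    h  = merge _≥?_ o es

    es-even : All Even es
    es-even = All-stair⁺ (λ n → Equivalence.from (even-stair-shift even-2 n)) even-even

    es-spaced : Spaced 2 es
    es-spaced = Spaced-stair⁺ {k = 0} even-desc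

    oddParts-h : oddParts h ≡ o
    oddParts-h = filter-mergeˡ odd? _≥?_ o es odd-odd (All.map (λ e o → o e) es-even)

    evenParts-h : evenParts h ≡ es
    evenParts-h = filter-mergeʳ even? _≥?_ o es odd-odd es-even

    h-apart : Linked (Apart 0 2) h
    h-apart = Equivalence.from (Linked-Apart⇔ even-0)
      (Linked-merge odd-desc (Spaced-mono z≤n es-spaced) , subst (Spaced 2) (sym evenParts-h) es-spaced)

    g-spaced : Spaced 2 (joinG ou) × Spaced 4 (evenParts (joinG ou))
    g-spaced = Equivalence.to (Linked-Apart⇔ even-2)
                 (Linked-stair⁺ (λ n → Equivalence.to (Apart-stair⇔ even-2 n)) h-apart)

    g-bound : All (suc (2 * c) ≤_) (joinG ou)
    g-bound = All-stair⁺ raise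
                (All-merge _≥?_ odd-bound (All-stair⁺ raise (All.map (≤-trans (n≤1+n _)) even-bound)))
      where
      raise : ∀ {x} n → suc (2 * c) ≤ x → suc (2 * c) ≤ n * 2 + x
      raise {x} n b = ≤-trans b (m≤n+m x (n * 2))

  splitG-joinG : splitG (joinG ou) ≡ ou
  splitG-joinG rewrite unstair-stair 2 h =
    cong₂ _,_ oddParts-h (trans (cong (unstair 2) evenParts-h) (unstair-stair 2 u))

  GPart-joinG : ∀ {n} → sum (joinG ou) ≡ n → GPart (suc c) r s n (joinG ou)
  GPart-joinG sum≡n =
    ( All.map (≤-trans (s≤s z≤n)) g-bound , Spaced-mono z≤n (proj₁ g-spaced) , sum≡n )
    , trans (count-stair even? (even-stair-shift even-2) h)
            (trans (cong length evenParts-h) (trans (length-stair 2 u) even-length))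
    , trans (count-stair odd? (odd-stair-shift even-2) h) (trans (cong length oddParts-h) odd-length)
    , All.map (λ {x} → subst (_≤ x) (sym (2*suc∸1 c))) g-bound
    , Spaced⇒DiffAtLeast (proj₁ g-spaced)
    , Spaced⇒DiffAtLeast (proj₂ g-spaced)

triangle-+ : ∀ m n → triangle (m + n) ≡ triangle m + (m * n + triangle n)
triangle-+ zero    n = refl
triangle-+ (suc m) n = begin
  m + n + triangle (m + n)                     ≡⟨ cong (m + n +_) (triangle-+ m n) ⟩
  m + n + (triangle m + (m * n + triangle n))  ≡⟨ regroup m n (triangle m) (triangle n) ⟩
  m + triangle m + (n + m * n + triangle n)    ∎
  where
  regroup : ∀ m n t u → m + n + (t + (m * n + u)) ≡ m + t + (n + m * n + u)
  regroup = solve-∀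

triangle-double : ∀ n → triangle n * 2 + n ≡ n * n
triangle-double zero    = refl
triangle-double (suc n) = begin
  (n + triangle n) * 2 + suc n   ≡⟨ regroup n (triangle n) ⟩
  n * 2 + 1 + (triangle n * 2 + n) ≡⟨ cong (n * 2 + 1 +_) (triangle-double n) ⟩
  n * 2 + 1 + n * n               ≡⟨ square n ⟩
  suc n * suc n                   ∎
  where
  regroup : ∀ n t → (n + t) * 2 + suc n ≡ n * 2 + 1 + (t * 2 + n)
  regroup = solve-∀
  square : ∀ n → n * 2 + 1 + n * n ≡ suc n * suc n
  square = solve-∀

triangle-balance : ∀ r s → triangle (s + r) * 2 + triangle r * 2 ≡ triangle s * 2 + r * evenShift r s
triangle-balance zero    s = cong (λ m → triangle m * 2 + 0) (+-identityʳ s)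
triangle-balance (suc r) s = begin
  triangle (s + suc r) * 2 + (r + triangle r) * 2
    ≡⟨ cong (λ t → t * 2 + (r + triangle r) * 2) (triangle-+ s (suc r)) ⟩
  (triangle s + (s * suc r + (r + triangle r))) * 2 + (r + triangle r) * 2
    ≡⟨ regroup (triangle s) s r (triangle r) ⟩
  triangle s * 2 + s * suc r * 2 + r * 2 + 2 * (triangle r * 2 + r)
    ≡⟨ cong (λ q → triangle s * 2 + s * suc r * 2 + r * 2 + 2 * q) (triangle-double r) ⟩
  triangle s * 2 + s * suc r * 2 + r * 2 + 2 * (r * r)
    ≡⟨ finish (triangle s) s r ⟩
  triangle s * 2 + suc r * (2 * (r + s))
    ∎
  where
  regroup : ∀ T s r t → (T + (s * suc r + (r + t))) * 2 + (r + t) * 2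
                       ≡ T * 2 + s * suc r * 2 + r * 2 + 2 * (t * 2 + r)
  regroup = solve-∀
  finish : ∀ T s r → T * 2 + s * suc r * 2 + r * 2 + 2 * (r * r) ≡ T * 2 + suc r * (2 * (r + s))
  finish = solve-∀

sum-joinG≡sum-joinH : ∀ {c r s ou} → PartitionPair c r s ou → sum (joinG ou) ≡ sum (joinH (evenShift r s) ou)
sum-joinG≡sum-joinH {c} {r} {s} {o , u} pp = begin
  sum (joinG (o , u))
    ≡⟨ sum-stair 2 h ⟩
  triangle (length h) * 2 + sum h
    ≡⟨ cong₂ (λ l t → triangle l * 2 + t) length-h sum-h ⟩
  triangle (s + r) * 2 + (sum o + (triangle r * 2 + sum u))
    ≡⟨ shuffle (triangle (s + r) * 2) (triangle r * 2) (triangle s * 2) (r * δ) (sum o) (sum u)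
               (triangle-balance r s) ⟩
  (triangle s * 2 + sum o) + (r * δ + sum u)
    ≡⟨ sym sum-joinH ⟩
  sum (joinH δ (o , u))
    ∎
  where
  open PartitionPair pp
  δ = evenShift r s
  h = merge _≥?_ o (stair 2 u)
  length-h : length h ≡ s + r
  length-h = trans (length-merge _≥?_ o (stair 2 u))
                   (cong₂ _+_ odd-length (trans (length-stair 2 u) even-length))
  sum-h : sum h ≡ sum o + (triangle r * 2 + sum u)
  sum-h = trans (sum-merge _≥?_ o (stair 2 u))
                (cong (sum o +_) (trans (sum-stair 2 u) (cong (λ l → triangle l * 2 + sum u) even-length)))
  sum-joinH : sum (joinH δ (o , u)) ≡ (triangle s * 2 + sum o) + (r * δ + sum u)
  sum-joinH = trans (sum-merge _≥?_ (stair 2 o) (map (δ +_) u))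
    (cong₂ _+_ (trans (sum-stair 2 o) (cong (λ l → triangle l * 2 + sum o) odd-length))
               (trans (sum-map-+ δ u) (cong (λ l → l * δ + sum u) even-length)))
  shuffle : ∀ A B C D O U → A + B ≡ C + D → A + (O + (B + U)) ≡ (C + O) + (D + U)
  shuffle A B C D O U eq = trans (pull A O B U) (trans (cong (_+ (O + U)) eq) (push C D O U))
    where
    pull : ∀ A O B U → A + (O + (B + U)) ≡ (A + B) + (O + U)
    pull = solve-∀
    push : ∀ C D O U → (C + D) + (O + U) ≡ (C + O) + (D + U)
    push = solve-∀

×-irrelevant : ∀ {a b} {A : Set a} {B : Set b} → Irrelevant A → Irrelevant B → Irrelevant (A × B)
×-irrelevant irrA irrB (a , b) (a′ , b′) = cong₂ _,_ (irrA a a′) (irrB b b′)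

⊎-irrelevant : ∀ {a b} {A : Set a} {B : Set b} → Irrelevant A → Irrelevant B → (A → ¬ B) → Irrelevant (A ⊎ B)
⊎-irrelevant irrA irrB disjoint (inj₁ a) (inj₁ a′) = cong inj₁ (irrA a a′)
⊎-irrelevant irrA irrB disjoint (inj₁ a) (inj₂ b)  = contradiction b (disjoint a)
⊎-irrelevant irrA irrB disjoint (inj₂ b) (inj₁ a)  = contradiction b (disjoint a)
⊎-irrelevant irrA irrB disjoint (inj₂ b) (inj₂ b′) = cong inj₂ (irrB b b′)

DiffAtLeast-irrelevant : ∀ k x y → Irrelevant (DiffAtLeast (suc k) x y)
DiffAtLeast-irrelevant k x y = ⊎-irrelevant ≤-irrelevant ≤-irrelevant
  (λ y<x x<y → <-asym (≤-trans (s≤s (m≤n+m y k)) y<x) (≤-trans (s≤s (m≤n+m x k)) x<y))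

guard-irrelevant : ∀ {p} {P : Set p} → Irrelevant P → Irrelevant (k ≡ 0 ⊎ (1 ≤ k × P))
guard-irrelevant irrP = ⊎-irrelevant ≡-irrelevant (×-irrelevant ≤-irrelevant irrP) (λ { refl (() , _) })

IsPartition-irrelevant : ∀ n ps → Irrelevant (IsPartition n ps)
IsPartition-irrelevant n ps =
  ×-irrelevant (All.irrelevant ≤-irrelevant) (×-irrelevant (Linked.irrelevant ≤-irrelevant) ≡-irrelevant)

HPart-irrelevant : ∀ i r s n ps → Irrelevant (HPart i r s n ps)
HPart-irrelevant i r s n ps =
  ×-irrelevant (IsPartition-irrelevant n ps) (×-irrelevant ≡-irrelevant (×-irrelevant ≡-irrelevant
  (×-irrelevant (AllPairs.irrelevant (DiffAtLeast-irrelevant 0 _ _))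
  (×-irrelevant (guard-irrelevant (All.irrelevant ≤-irrelevant))
                (guard-irrelevant (All.irrelevant ≤-irrelevant))))))

GPart-irrelevant : ∀ i r s n ps → Irrelevant (GPart i r s n ps)
GPart-irrelevant i r s n ps =
  ×-irrelevant (IsPartition-irrelevant n ps) (×-irrelevant ≡-irrelevant (×-irrelevant ≡-irrelevant
  (×-irrelevant (All.irrelevant ≤-irrelevant)
  (×-irrelevant (AllPairs.irrelevant (DiffAtLeast-irrelevant 1 _ _))
                (AllPairs.irrelevant (DiffAtLeast-irrelevant 3 _ _))))))

Σ-≡ : ∀ {p} {P : List ℕ → Set p} → (∀ xs → Irrelevant (P xs)) →
      ∀ {px : P xs} {py : P ys} → xs ≡ ys → _≡_ {A = Σ (List ℕ) P} (xs , px) (ys , py)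
Σ-≡ irr {px} {py} refl = cong (_ ,_) (irr _ px py)

partitions-bijection : ∀ c r s n → Σ (List ℕ) (HPart (suc c) r s n) ↔ Σ (List ℕ) (GPart (suc c) r s n)
partitions-bijection c r s n = mk↔ₛ′ to from to∘from from∘to
  where
  δ = evenShift r s

  to : Σ (List ℕ) (HPart (suc c) r s n) → Σ (List ℕ) (GPart (suc c) r s n)
  to (ps , H@((_ , _ , sum≡n) , _)) = joinG (splitH δ ps) , JoinG.GPart-joinG pair
    (trans (sum-joinG≡sum-joinH pair) (trans (cong sum joinH-splitH) sum≡n))
    where open SplitH H

  from : Σ (List ℕ) (GPart (suc c) r s n) → Σ (List ℕ) (HPart (suc c) r s n)
  from (g , G@((_ , _ , sum≡n) , _)) = joinH δ (splitG g) , JoinH.HPart-joinH pair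
    (trans (sym (sum-joinG≡sum-joinH pair)) (trans (cong sum joinG-splitG) sum≡n))
    where open SplitG G

  to∘from : ∀ y → to (from y) ≡ y
  to∘from (g , G) = Σ-≡ (GPart-irrelevant (suc c) r s n)
    (trans (cong joinG (JoinH.splitH-joinH pair)) joinG-splitG)
    where open SplitG G

  from∘to : ∀ x → from (to x) ≡ x
  from∘to (ps , H) = Σ-≡ (HPart-irrelevant (suc c) r s n)
    (trans (cong (joinH δ) (JoinG.splitG-joinG pair)) joinH-splitH)
    where open SplitH H

theorem2p1 : (i : ℕ) → (i ≡ 1 ⊎ i ≡ 2) → (r s n : ℕ) →
    Σ (List ℕ) (HPart i r s n) ↔ Σ (List ℕ) (GPart i r s n)
theorem2p1 _ (inj₁ refl) = partitions-bijection 0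
theorem2p1 _ (inj₂ refl) = partitions-bijection 1
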